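{- If there exists a set of $\mu$ mutually orthogonal $\ell$-cycle systems of order $n$, then $\mu\le n-2$. That is, $\mu(\ell,n)\le n-2$.
   Context: An $\ell$-cycle system of order $n$ is a set of $\ell$-cycles whose edge sets partition the edge set of $K_n$. Two such systems $\mathcal F,\mathcal F'$ are orthogonal if every $C\in\mathcal F$ and $C'\in\mathcal F'$ share at most one edge; mutually orthogonal means pairwise orthogonal. $\mu(\ell,n)$ is the maximum size of a set of mutually orthogonal $\ell$-cycle systems of order $n$. -}

module Defs where

open import Data.Nat using (ℕ; zero; suc)
open import Data.Fin using (Fin; toℕ)
open import Data.Product using (Σ; ∃; _×_; _,_)
open import Data.Sum using (_⊎_)
open import Relation.Binary.PropositionalEquality using (_≡_; _≢_)
open import Function.Definitions using (Injective)

CycAdj : (ℓ : ℕ) → Fin ℓ → Fin ℓ → Set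
CycAdj ℓ i j = (suc (toℕ i) ≡ toℕ j) ⊎ ((suc (toℕ i) ≡ ℓ) × (toℕ j ≡ 0))

-- An ℓ-cycle in K_n (vertex set Fin n): a cyclic sequence of ℓ
-- distinct vertices v₀ v₁ … v_{ℓ-1}, with edges {v_i , v_{i+1 mod ℓ}}.
record Cycle (ℓ n : ℕ) : Set where
  field
    vert : Fin ℓ → Fin n
    inj  : Injective _≡_ _≡_ vert
open Cycle public

HasEdge : ∀ {ℓ n} → Cycle ℓ n → Fin n → Fin n → Set
HasEdge {ℓ} C x y =
  Σ (Fin ℓ) λ i → Σ (Fin ℓ) λ j → CycAdj ℓ i j ×
    ((vert C i ≡ x × vert C j ≡ y) ⊎ (vert C i ≡ y × vert C j ≡ x))

record CycleSystem (ℓ n : ℕ) : Set where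
  field
    size      : ℕ
    cyc       : Fin size → Cycle ℓ n
    partition : ∀ x y → x ≢ y →
                Σ (Fin size) λ c → HasEdge (cyc c) x y ×
                  (∀ c′ → HasEdge (cyc c′) x y → c′ ≡ c)
open CycleSystem public

ShareAtMostOneEdge : ∀ {ℓ n} → Cycle ℓ n → Cycle ℓ n → Set
ShareAtMostOneEdge {n = n} C D =
  ∀ (x y x′ y′ : Fin n) →
    HasEdge C x y → HasEdge D x y → HasEdge C x′ y′ → HasEdge D x′ y′ →
    (x ≡ x′ × y ≡ y′) ⊎ (x ≡ y′ × y ≡ x′)

Orthogonal : ∀ {ℓ n} → CycleSystem ℓ n → CycleSystem ℓ n → Set
Orthogonal F G = ∀ c d → ShareAtMostOneEdge (cyc F c) (cyc G d)

MutuallyOrthogonal : ∀ {ℓ n μ} → (Fin μ → CycleSystem ℓ n) → Set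
MutuallyOrthogonal {μ = μ} F = ∀ (i j : Fin μ) → i ≢ j → Orthogonal (F i) (F j)

-- Fix an edge {x, y} of K_n. In each system the cycle through {x, y} continues past y
-- to a third vertex z. Two orthogonal systems cannot give the same z, since their
-- cycles would then share both edges {x, y} and {y, z}. So z is an injection from the
-- systems into the n − 2 vertices other than x and y.
module Submission where

open import Defs
open import Data.Nat using (ℕ; _≤_; _∸_; zero; suc; s≤s)
open import Data.Nat.Properties using (1+n≢n; m≢1+n+m; ≤-trans; n≤1+n)
open import Data.Fin using (Fin; toℕ; fromℕ; inject₁) renaming (zero to fzero; suc to fsuc)
open import Data.Fin.Properties using (toℕ-fromℕ; toℕ-inject₁; injective⇒≤; _≟_)
open import Data.Product using (Σ; ∃; _×_; _,_; proj₁; proj₂)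
open import Data.Sum using (_⊎_; inj₁; inj₂)
open import Data.Empty using (⊥; ⊥-elim)
open import Function.Definitions using (Injective)
open import Relation.Nullary using (¬_; yes; no; contradiction)
open import Relation.Binary.PropositionalEquality using (_≡_; _≢_; refl; sym; trans; cong; subst)

cycAdj-irrefl : ∀ {ℓ} → 2 ≤ ℓ → (i : Fin ℓ) → ¬ CycAdj ℓ i i
cycAdj-irrefl _             i (inj₁ e)         = 1+n≢n e
cycAdj-irrefl (s≤s (s≤s _)) i (inj₂ (e , i≡0)) = contradiction (trans (cong suc (sym i≡0)) e) λ ()

cycAdj-asym : ∀ {ℓ} → 3 ≤ ℓ → (i j : Fin ℓ) → CycAdj ℓ i j → ¬ CycAdj ℓ j i
cycAdj-asym {ℓ} (s≤s (s≤s (s≤s _))) i j = asym (toℕ i) (toℕ j)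
  where
  asym : ∀ a b → (suc a ≡ b) ⊎ (suc a ≡ ℓ × b ≡ 0) →
         ¬ ((suc b ≡ a) ⊎ (suc b ≡ ℓ × a ≡ 0))
  asym a .(suc a) (inj₁ refl) (inj₁ e)             = m≢1+n+m a (sym e)
  asym .0 .1      (inj₁ refl) (inj₂ (() , refl))
  asym .1 .0      (inj₂ (() , refl)) (inj₁ refl)
  asym .0 .0      (inj₂ (() , refl)) (inj₂ (_ , refl))

cycAdj-successor : ∀ {ℓ} (i : Fin ℓ) → ∃ λ j → CycAdj ℓ i j
cycAdj-successor {suc zero}    fzero    = fzero , inj₂ (refl , refl)
cycAdj-successor {suc (suc k)} fzero    = fsuc fzero , inj₁ refl
cycAdj-successor {suc (suc k)} (fsuc i) with cycAdj-successor i
... | j , inj₁ e       = fsuc j , inj₁ (cong suc e)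
... | _ , inj₂ (e , _) = fzero , inj₂ (cong suc e , refl)

cycAdj-predecessor : ∀ {ℓ} (j : Fin ℓ) → ∃ λ i → CycAdj ℓ i j
cycAdj-predecessor {suc k} fzero    = fromℕ k , inj₂ (cong suc (toℕ-fromℕ k) , refl)
cycAdj-predecessor {suc k} (fsuc j) = inject₁ j , inj₁ (cong suc (toℕ-inject₁ j))

HasEdge⇒≢ : ∀ {ℓ n} → 2 ≤ ℓ → (C : Cycle ℓ n) {x y : Fin n} → HasEdge C x y → x ≢ y
HasEdge⇒≢ 2≤ℓ C (i , j , adj , inj₁ (refl , refl)) e = cycAdj-irrefl 2≤ℓ i (subst (CycAdj _ i) (sym (inj C e)) adj)
HasEdge⇒≢ 2≤ℓ C (i , j , adj , inj₂ (refl , refl)) e = cycAdj-irrefl 2≤ℓ i (subst (CycAdj _ i) (inj C e) adj)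

extend-edge : ∀ {ℓ n} → 3 ≤ ℓ → (C : Cycle ℓ n) {x y : Fin n} → HasEdge C x y →
              ∃ λ z → HasEdge C y z × z ≢ x
extend-edge 3≤ℓ C (i , j , adj , inj₁ (refl , refl)) =
  let s , adj′ = cycAdj-successor j
  in vert C s , (j , s , adj′ , inj₁ (refl , refl)) ,
     λ e → cycAdj-asym 3≤ℓ i j adj (subst (CycAdj _ j) (inj C e) adj′)
extend-edge 3≤ℓ C (i , j , adj , inj₂ (refl , refl)) =
  let r , adj′ = cycAdj-predecessor i
  in vert C r , (r , i , adj′ , inj₂ (refl , refl)) ,
     λ e → cycAdj-asym 3≤ℓ i j adj (subst (λ t → CycAdj _ t i) (inj C e) adj′)

shareAtMostOneEdge⇒¬sharedPath : ∀ {ℓ n} {C D : Cycle ℓ n} → ShareAtMostOneEdge C D →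
  ∀ {x y z} → x ≢ y → z ≢ x →
  HasEdge C x y → HasEdge D x y → HasEdge C y z → HasEdge D y z → ⊥
shareAtMostOneEdge⇒¬sharedPath share x≢y z≢x Cxy Dxy Cyz Dyz
  with share _ _ _ _ Cxy Dxy Cyz Dyz
... | inj₁ (x≡y , _) = x≢y x≡y
... | inj₂ (x≡z , _) = z≢x (sym x≡z)

module ThirdVertex {ℓ n μ} (3≤ℓ : 3 ≤ ℓ) (F : Fin μ → CycleSystem ℓ n) (mo : MutuallyOrthogonal F)
                   {x y : Fin n} (x≢y : x ≢ y) where

  cycleThrough : (i : Fin μ) → Σ (Fin (size (F i))) λ c → HasEdge (cyc (F i) c) x y
  cycleThrough i = let c , e , _ = partition (F i) x y x≢y in c , e

  C : (i : Fin μ) → Cycle ℓ n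
  C i = cyc (F i) (proj₁ (cycleThrough i))

  extension : (i : Fin μ) → ∃ λ z → HasEdge (C i) y z × z ≢ x
  extension i = extend-edge 3≤ℓ (C i) (proj₂ (cycleThrough i))

  third : Fin μ → Fin n
  third i = proj₁ (extension i)

  third≢x : ∀ i → third i ≢ x
  third≢x i = proj₂ (proj₂ (extension i))

  third≢y : ∀ i → third i ≢ y
  third≢y i e = HasEdge⇒≢ (≤-trans (n≤1+n 2) 3≤ℓ) (C i) (proj₁ (proj₂ (extension i))) (sym e)

  third-injective : Injective _≡_ _≡_ third
  third-injective {i} {j} e with i ≟ j
  ... | yes i≡j = i≡j
  ... | no  i≢j = ⊥-elim (shareAtMostOneEdge⇒¬sharedPath {C = C i} {D = C j}
                    (mo i j i≢j (proj₁ (cycleThrough i)) (proj₁ (cycleThrough j)))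
                    x≢y (third≢x i)
                    (proj₂ (cycleThrough i)) (proj₂ (cycleThrough j))
                    (proj₁ (proj₂ (extension i)))
                    (subst (HasEdge (C j) y) (sym e) (proj₁ (proj₂ (extension j)))))

dropFirstTwo : ∀ {m} (t : Fin (suc (suc m))) → t ≢ fzero → t ≢ fsuc fzero → Fin m
dropFirstTwo fzero           t≢0 _   = ⊥-elim (t≢0 refl)
dropFirstTwo (fsuc fzero)    _   t≢1 = ⊥-elim (t≢1 refl)
dropFirstTwo (fsuc (fsuc t)) _   _   = t

dropFirstTwo-injective : ∀ {m} (t u : Fin (suc (suc m))) t≢0 t≢1 u≢0 u≢1 →
  dropFirstTwo t t≢0 t≢1 ≡ dropFirstTwo u u≢0 u≢1 → t ≡ u
dropFirstTwo-injective fzero           _               t≢0 _   _   _   _ = ⊥-elim (t≢0 refl)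
dropFirstTwo-injective (fsuc fzero)    _               _   t≢1 _   _   _ = ⊥-elim (t≢1 refl)
dropFirstTwo-injective (fsuc (fsuc _)) fzero           _   _   u≢0 _   _ = ⊥-elim (u≢0 refl)
dropFirstTwo-injective (fsuc (fsuc _)) (fsuc fzero)    _   _   _   u≢1 _ = ⊥-elim (u≢1 refl)
dropFirstTwo-injective (fsuc (fsuc _)) (fsuc (fsuc _)) _   _   _   _   e = cong (λ t → fsuc (fsuc t)) e

injective-avoiding-0-1⇒≤ : ∀ {μ m} (f : Fin μ → Fin (suc (suc m))) → Injective _≡_ _≡_ f →
  (∀ i → f i ≢ fzero) → (∀ i → f i ≢ fsuc fzero) → μ ≤ m
injective-avoiding-0-1⇒≤ f f-inj f≢0 f≢1 =
  injective⇒≤ {f = λ i → dropFirstTwo (f i) (f≢0 i) (f≢1 i)}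
    (λ {i} {j} e → f-inj (dropFirstTwo-injective (f i) (f j) _ _ _ _ e))

lemma19 : (ℓ n μ : ℕ) → 3 ≤ ℓ → ℓ ≤ n →
          (F : Fin μ → CycleSystem ℓ n) → MutuallyOrthogonal F →
          μ ≤ n ∸ 2
lemma19 ℓ zero          μ 3≤ℓ ℓ≤n F mo = contradiction (≤-trans 3≤ℓ ℓ≤n) λ ()
lemma19 ℓ (suc zero)    μ 3≤ℓ ℓ≤n F mo = contradiction (≤-trans 3≤ℓ ℓ≤n) λ { (s≤s ()) }
lemma19 ℓ (suc (suc m)) μ 3≤ℓ ℓ≤n F mo =
  injective-avoiding-0-1⇒≤ third third-injective third≢x third≢y
  where open ThirdVertex 3≤ℓ F mo {fzero} {fsuc fzero} (λ ())
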